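{- Let $n\ge 1$ and let $A=(A_1,\ldots,A_n)$ and $B=(B_1,\ldots,B_n)$ be permutations of $\{1,\ldots,n\}$ such that $\mathrm{SUS}(A)\le 3$ and $\mathrm{SUS}(B)\le 3$. If $\mathcal{M}(A)=\mathcal{M}(B)$, then $A=B$.
   Context: For a sequence $P=(P_1,\ldots,P_n)$ of positive integers (packet IDs), define for each time $i\in\{1,\ldots,n\}$: $H_i=\max\{P_1,\ldots,P_i\}$ (the highest ID seen so far), and $L_i$ = the largest integer $k\ge 0$ such that $\{1,2,\ldots,k\}\subseteq\{P_1,\ldots,P_i\}$ (the highest ID that can be delivered in order so far). The buffer sequence of $P$ is $\mathcal{M}(P)=(\mathcal{M}_1,\ldots,\mathcal{M}_n)$ with $\mathcal{M}_i=H_i-L_i$. For example, $\mathcal{M}((4,3,2,1))=(4,4,4,0)$. For a sequence of integers $A$, $\mathrm{SUS}(A)$ (shuffled up-sequences) denotes the minimum number of ascending subsequences into which the sequence $A$ can be partitioned. -}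

module Defs where

open import Data.Nat using (ℕ; zero; suc; _∸_; _⊔_; _<_; _≤_)
open import Data.Bool using (true; false)
open import Data.Nat.Properties using (_≟_)
open import Data.Fin using (Fin; toℕ)
open import Data.Fin.Base using () renaming (_<_ to _<ᶠ_)
open import Data.List using (List; []; _∷_; map; upTo; length; take; foldr; any)
open import Data.Vec using (Vec; lookup; toList)
open import Data.List.Relation.Binary.Permutation.Propositional using (_↭_)
open import Data.List.Membership.DecPropositional _≟_ using (_∈?_)
open import Relation.Nullary.Decidable using (does)
open import Relation.Binary.PropositionalEquality using (_≡_)

IsPermutation : {n : ℕ} → Vec ℕ n → Set
IsPermutation {n} A = toList A ↭ map suc (upTo n)

maxList : List ℕ → ℕ
maxList = foldr _⊔_ 0

-- largest k ≥ 0 with {1..k} ⊆ xs: starting from k, keep increasing while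
-- k+1 ∈ xs; fuel bounds the search (k ≤ length xs always suffices).
inOrderFrom : ℕ → ℕ → List ℕ → ℕ
inOrderFrom zero k xs = k
inOrderFrom (suc fuel) k xs with does (suc k ∈? xs)
... | true  = inOrderFrom fuel (suc k) xs
... | false = k

inOrder : List ℕ → ℕ
inOrder xs = inOrderFrom (length xs) 0 xs

bufferAt : List ℕ → ℕ → ℕ
bufferAt P i = maxList (take i P) ∸ inOrder (take i P)

buffer : List ℕ → List ℕ
buffer P = map (bufferAt P) (map suc (upTo (length P)))

-- SUS(A) ≤ k : A can be partitioned into at most k ascending subsequences,
-- i.e. there is a colouring of positions with k colours such that each
-- colour class is ascending (strictly, by position).
SUS≤ : {n : ℕ} → ℕ → Vec ℕ n → Set
SUS≤ {n} k A = Σ' (Fin n → Fin k) λ c →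
  (i j : Fin n) → i <ᶠ j → c i ≡ c j → lookup A i < lookup A j
  where
  open import Data.Product using () renaming (Σ to Σ')

-- Equal buffer sequences force equal histories of (H, L).  Appending a fresh packet x to a history
-- with maximum H and in-order level L leaves the buffer at most H − L when x < H, and otherwise
-- empties it (x = L + 1 = H + 1) or makes it x − L > H − L; so the buffer value determines the new H,
-- and then M = H − L determines the new L.
--
-- Suppose A and B first differ after a common prefix R, A continuing with x and B with y > x.
-- Equal maxima after this step force y < H := max R.  The packet x arrives later in B; just before
-- it does, both histories have the same level L, and w := L + 1 < x is missing from both (it is not x,
-- which A has already received).  So w arrives after x in B, and H > y > x > w is a decreasing
-- subsequence of B of length 4, which cannot be split among 3 ascending subsequences.
module Submission where

open import Defs
open import Function using (_∘_)
open import Data.Empty using (⊥; ⊥-elim)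
open import Data.Sum using (inj₁; inj₂)
open import Data.Product using (_×_; _,_; proj₁; proj₂)
open import Data.Nat using (ℕ; zero; suc; _+_; _∸_; _⊔_; _<_; _≤_; _≥_; _>_; z≤n; s≤s)
open import Data.Nat.Properties
open import Data.Fin using (Fin; zero; suc; toℕ) renaming (_<_ to _<ᶠ_)
open import Data.Fin.Properties using (pigeonhole; injective⇒≤; toℕ<n; toℕ-injective)
open import Data.List as List using (List; []; _∷_; _++_; [_]; map; upTo; length; take)
open import Data.List.Properties using (++-assoc; ++-identityʳ; take-all; ∷-injective)
open import Data.List.Membership.Propositional using (_∈_; _∉_)
open import Data.List.Membership.Propositional.Properties
  using (∈-++⁺ˡ; ∈-++⁺ʳ; ∈-++⁻; ∈-∃++; ∈-map⁺; ∈-map⁻; ∈-upTo⁺; ∈-upTo⁻; ∈-lookup)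
open import Data.List.Membership.DecPropositional _≟_ using (_∈?_)
open import Data.List.Relation.Unary.Any using (here; there; index)
open import Data.List.Relation.Unary.Any.Properties using (lookup-index)
open import Data.List.Relation.Unary.All as All using (All; _∷_)
open import Data.List.Relation.Unary.AllPairs using (AllPairs; _∷_)
open import Data.List.Relation.Unary.Linked using ([-]; _∷_)
open import Data.List.Relation.Unary.Linked.Properties using (Linked⇒AllPairs)
open import Data.List.Relation.Unary.Unique.Propositional using (Unique)
import Data.List.Relation.Unary.Unique.Propositional.Properties as Unique
open import Data.List.Relation.Binary.Sublist.Propositional using (_⊆_; []; _∷_; _∷ʳ_; from∈)
open import Data.List.Relation.Binary.Sublist.Propositional.Properties using (++⁺; ++⁺ˡ)
open import Data.List.Relation.Binary.Permutation.Propositional using (_↭_; ↭-sym; ↭⇒↭ₛ)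
open import Data.List.Relation.Binary.Permutation.Propositional.Properties using (∈-resp-↭; ↭-length)
import Data.List.Relation.Binary.Permutation.Setoid.Properties as PermutationSetoid
open import Data.Vec as Vec using (Vec; toList)
open import Data.Vec.Properties using (length-toList; toList-injective)
open import Data.Vec.Relation.Binary.Equality.Cast using (cast-is-id)
open import Relation.Nullary using (¬_; yes; no)
open import Relation.Binary.Definitions using (tri<; tri≈; tri>)
open import Relation.Binary.PropositionalEquality
  using (_≡_; _≢_; refl; sym; trans; cong; subst; subst₂; setoid; module ≡-Reasoning)

maxList-snoc : ∀ S x → maxList (S ++ [ x ]) ≡ maxList S ⊔ x
maxList-snoc []      x = ⊔-comm x 0
maxList-snoc (a ∷ S) x = trans (cong (a ⊔_) (maxList-snoc S x)) (sym (⊔-assoc a (maxList S) x))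

maxList-snoc-≤ : ∀ S {x} → x ≤ maxList S → maxList (S ++ [ x ]) ≡ maxList S
maxList-snoc-≤ S {x} x≤max = trans (maxList-snoc S x) (m≥n⇒m⊔n≡m x≤max)

maxList-snoc-> : ∀ S {x} → maxList S < x → maxList (S ++ [ x ]) ≡ x
maxList-snoc-> S {x} max<x = trans (maxList-snoc S x) (m≤n⇒m⊔n≡n (<⇒≤ max<x))

∈⇒≤maxList : ∀ {x S} → x ∈ S → x ≤ maxList S
∈⇒≤maxList {S = a ∷ S} (here refl)  = m≤m⊔n a (maxList S)
∈⇒≤maxList {S = a ∷ S} (there x∈S) = ≤-trans (∈⇒≤maxList x∈S) (m≤n⊔m a (maxList S))

maxList∈ : ∀ S → 0 < maxList S → maxList S ∈ S
maxList∈ (a ∷ S) 0<max with ⊔-sel a (maxList S)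
... | inj₁ max≡a = here max≡a
... | inj₂ max≡ = there (subst (_∈ S) (sym max≡) (maxList∈ S (subst (0 <_) max≡ 0<max)))

Fresh : List ℕ → ℕ → Set
Fresh S x = 0 < x × x ∉ S

fresh⇒<maxList : ∀ {S x} → Fresh S x → x ≤ maxList S → x < maxList S
fresh⇒<maxList {S} (0<x , x∉S) x≤max =
  ≤∧≢⇒< x≤max (λ x≡max → x∉S (subst (_∈ S) (sym x≡max) (maxList∈ S (<-≤-trans 0<x x≤max))))

snoc-maxList-≡⇒<maxList : ∀ {R x y} → Fresh R y → x < y →
  maxList (R ++ [ x ]) ≡ maxList (R ++ [ y ]) → y < maxList R
snoc-maxList-≡⇒<maxList {R} {x} {y} y-fresh x<y same with y ≤? maxList R
... | yes y≤max = fresh⇒<maxList y-fresh y≤max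
... | no  y≰max = ⊥-elim (<⇒≢ (⊔-lub (≰⇒> y≰max) x<y)
        (trans (sym (maxList-snoc R x)) (trans same (maxList-snoc-> R (≰⇒> y≰max)))))

Covers : List ℕ → ℕ → Set
Covers S k = ∀ {j} → 0 < j → j ≤ k → j ∈ S

Covers-suc : ∀ {S k} → Covers S k → suc k ∈ S → Covers S (suc k)
Covers-suc covers k+1∈S 0<j j≤k+1 with m≤n⇒m<n∨m≡n j≤k+1
... | inj₁ j<k+1 = covers 0<j (≤-pred j<k+1)
... | inj₂ refl  = k+1∈S

Covers-++ : ∀ {S k} T → Covers S k → Covers (S ++ T) k
Covers-++ T covers 0<j j≤k = ∈-++⁺ˡ (covers 0<j j≤k)

Covers⇒≤length : ∀ {S k} → Covers S k → k ≤ length S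
Covers⇒≤length {S} {k} covers = injective⇒≤ {f = position} position-injective
  where
  member : (i : Fin k) → suc (toℕ i) ∈ S
  member i = covers (s≤s z≤n) (toℕ<n i)
  position : Fin k → Fin (length S)
  position i = index (member i)
  position-injective : ∀ {i j} → position i ≡ position j → i ≡ j
  position-injective {i} {j} same = toℕ-injective (suc-injective (begin
    suc (toℕ i)                  ≡⟨ lookup-index (member i) ⟩
    List.lookup S (position i)   ≡⟨ cong (List.lookup S) same ⟩
    List.lookup S (position j)   ≡⟨ sym (lookup-index (member j)) ⟩
    suc (toℕ j)                  ∎))
    where open ≡-Reasoning

IsInOrder : List ℕ → ℕ → Set
IsInOrder S L = Covers S L × suc L ∉ S

IsInOrder-unique : ∀ {S L L′} → IsInOrder S L → IsInOrder S L′ → L ≡ L′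
IsInOrder-unique {L = L} {L′} (covers , next∉) (covers′ , next′∉) with <-cmp L L′
... | tri< L<L′ _ _ = ⊥-elim (next∉ (covers′ (s≤s z≤n) L<L′))
... | tri≈ _ L≡L′ _ = L≡L′
... | tri> _ _ L′<L = ⊥-elim (next′∉ (covers (s≤s z≤n) L′<L))

-- The fuel suffices since no list covers more than its length.
inOrderFrom-isInOrder : ∀ S fuel k → fuel + k ≡ length S → Covers S k →
  IsInOrder S (inOrderFrom fuel k S)
inOrderFrom-isInOrder S zero k k≡length covers =
  covers , λ k+1∈S → 1+n≰n (subst (suc k ≤_) (sym k≡length) (Covers⇒≤length (Covers-suc covers k+1∈S)))
inOrderFrom-isInOrder S (suc fuel) k fuel+k≡length covers with suc k ∈? S
... | yes k+1∈S = inOrderFrom-isInOrder S fuel (suc k) (trans (+-suc fuel k) fuel+k≡length)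
                    (Covers-suc covers k+1∈S)
... | no  k+1∉S = covers , k+1∉S

inOrder-isInOrder : ∀ S → IsInOrder S (inOrder S)
inOrder-isInOrder S =
  inOrderFrom-isInOrder S (length S) 0 (+-identityʳ _) (λ 0<j j≤0 → ⊥-elim (<⇒≱ 0<j j≤0))

IsInOrder⇒≤maxList : ∀ {S L} → IsInOrder S L → L ≤ maxList S
IsInOrder⇒≤maxList {L = zero}  _            = z≤n
IsInOrder⇒≤maxList {L = suc L} (covers , _) = ∈⇒≤maxList (covers (s≤s z≤n) ≤-refl)

IsInOrder-mono-++ : ∀ {S L L′} T → IsInOrder S L → IsInOrder (S ++ T) L′ → L ≤ L′
IsInOrder-mono-++ T (covers , _) (_ , next′∉) =
  ≮⇒≥ (λ L′<L → next′∉ (∈-++⁺ˡ (covers (s≤s z≤n) L′<L)))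

fresh⇒>level : ∀ {S L y} → IsInOrder S L → Fresh S y → L < y
fresh⇒>level (covers , _) (0<y , y∉S) = ≰⇒> (λ y≤L → y∉S (covers 0<y y≤L))

IsInOrder-snoc : ∀ {S L x} → IsInOrder S L → x ≢ suc L → IsInOrder (S ++ [ x ]) L
IsInOrder-snoc {S} (covers , next∉) x≢next = Covers-++ [ _ ] covers , next∉′
  where
  next∉′ : _ ∉ S ++ [ _ ]
  next∉′ next∈ with ∈-++⁻ S next∈
  ... | inj₁ next∈S      = next∉ next∈S
  ... | inj₂ (here next≡x) = x≢next (sym next≡x)

IsInOrder-snoc-next : ∀ {S L} → IsInOrder S L → maxList S ≤ L → IsInOrder (S ++ [ suc L ]) (suc L)
IsInOrder-snoc-next {S} {L} (covers , _) max≤L =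
  Covers-suc (Covers-++ [ suc L ] covers) (∈-++⁺ʳ S (here refl)) , next∉
  where
  next∉ : suc (suc L) ∉ S ++ [ suc L ]
  next∉ next∈ with ∈-++⁻ S next∈
  ... | inj₁ next∈S          = 1+n≰n (≤-trans (∈⇒≤maxList next∈S) (≤-trans max≤L (n≤1+n L)))
  ... | inj₂ (here next≡L+1) = 1+n≢n next≡L+1

bufferSize : List ℕ → ℕ
bufferSize S = maxList S ∸ inOrder S

bufferSize-isInOrder : ∀ {S L} → IsInOrder S L → bufferSize S ≡ maxList S ∸ L
bufferSize-isInOrder {S} S-level = cong (maxList S ∸_) (IsInOrder-unique (inOrder-isInOrder S) S-level)

bufferSize-snoc-≤ : ∀ {S L x} → IsInOrder S L → x ≤ maxList S → bufferSize (S ++ [ x ]) ≤ maxList S ∸ L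
bufferSize-snoc-≤ {S} {L} {x} S-level x≤max = begin
  bufferSize (S ++ [ x ])         ≡⟨ cong (_∸ inOrder (S ++ [ x ])) (maxList-snoc-≤ S x≤max) ⟩
  maxList S ∸ inOrder (S ++ [ x ]) ≤⟨ ∸-monoʳ-≤ (maxList S)
                                        (IsInOrder-mono-++ [ x ] S-level (inOrder-isInOrder _)) ⟩
  maxList S ∸ L                   ∎
  where open ≤-Reasoning

bufferSize-snoc-next : ∀ {S L} → IsInOrder S L → maxList S ≤ L → bufferSize (S ++ [ suc L ]) ≡ 0
bufferSize-snoc-next {S} {L} S-level max≤L = begin
  bufferSize (S ++ [ suc L ])          ≡⟨ bufferSize-isInOrder (IsInOrder-snoc-next S-level max≤L) ⟩
  maxList (S ++ [ suc L ]) ∸ suc L     ≡⟨ cong (_∸ suc L) (maxList-snoc-> S (s≤s max≤L)) ⟩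
  suc L ∸ suc L                        ≡⟨ n∸n≡0 (suc L) ⟩
  0                                    ∎
  where open ≡-Reasoning

bufferSize-snoc-jump : ∀ {S L x} → IsInOrder S L → maxList S < x → x ≢ suc L →
  bufferSize (S ++ [ x ]) ≡ x ∸ L
bufferSize-snoc-jump {S} {L} S-level max<x x≢next =
  trans (bufferSize-isInOrder (IsInOrder-snoc S-level x≢next)) (cong (_∸ L) (maxList-snoc-> S max<x))

module _ {S T L} (S-level : IsInOrder S L) (T-level : IsInOrder T L) (sameMax : maxList S ≡ maxList T) where

  snoc-high≢snoc-low : ∀ {x y} → maxList S < x → Fresh T y → y ≤ maxList T →
    bufferSize (S ++ [ x ]) ≢ bufferSize (T ++ [ y ])
  snoc-high≢snoc-low {x} {y} max<x y-fresh y≤max same with x ≟ suc L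
  ... | yes refl   =
    <⇒≱ (<-≤-trans (fresh⇒>level T-level y-fresh) y≤max) (subst (_≤ L) sameMax (≤-pred max<x))
  ... | no  x≢next = <⇒≱ (∸-monoˡ-< max<x (IsInOrder⇒≤maxList S-level)) (begin
    x ∸ L                  ≡⟨ sym (bufferSize-snoc-jump S-level max<x x≢next) ⟩
    bufferSize (S ++ [ x ]) ≡⟨ same ⟩
    bufferSize (T ++ [ y ]) ≤⟨ bufferSize-snoc-≤ T-level y≤max ⟩
    maxList T ∸ L          ≡⟨ cong (_∸ L) (sym sameMax) ⟩
    maxList S ∸ L          ∎)
    where open ≤-Reasoning

  snoc-next≢snoc-jump : ∀ {y} → maxList S ≤ L → maxList T < y → y ≢ suc L →
    bufferSize (S ++ [ suc L ]) ≢ bufferSize (T ++ [ y ])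
  snoc-next≢snoc-jump max≤L max<y y≢next same =
    <⇒≢ (m<n⇒0<n∸m (≤-<-trans (IsInOrder⇒≤maxList T-level) max<y))
      (trans (sym (bufferSize-snoc-next S-level max≤L))
             (trans same (bufferSize-snoc-jump T-level max<y y≢next)))

  snoc-jump-injective : ∀ {x y} → maxList S < x → maxList T < y → x ≢ suc L → y ≢ suc L →
    bufferSize (S ++ [ x ]) ≡ bufferSize (T ++ [ y ]) → x ≡ y
  snoc-jump-injective max<x max<y x≢next y≢next same =
    ∸-cancelʳ-≡ (≤-trans (IsInOrder⇒≤maxList S-level) (<⇒≤ max<x))
                (≤-trans (IsInOrder⇒≤maxList T-level) (<⇒≤ max<y))
      (trans (sym (bufferSize-snoc-jump S-level max<x x≢next))
             (trans same (bufferSize-snoc-jump T-level max<y y≢next)))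

snoc-high-injective : ∀ {S T L x y} → IsInOrder S L → IsInOrder T L → maxList S ≡ maxList T →
  maxList S < x → maxList T < y → bufferSize (S ++ [ x ]) ≡ bufferSize (T ++ [ y ]) → x ≡ y
snoc-high-injective {L = L} {x} {y} S-level T-level sameMax max<x max<y same with x ≟ suc L | y ≟ suc L
... | yes x≡next | yes y≡next = trans x≡next (sym y≡next)
... | yes refl   | no  y≢next =
  ⊥-elim (snoc-next≢snoc-jump S-level T-level sameMax (≤-pred max<x) max<y y≢next same)
... | no  x≢next | yes refl   =
  ⊥-elim (snoc-next≢snoc-jump T-level S-level (sym sameMax) (≤-pred max<y) max<x x≢next (sym same))
... | no  x≢next | no  y≢next = snoc-jump-injective S-level T-level sameMax max<x max<y x≢next y≢next same

snoc-sameMax : ∀ {S T L x y} → IsInOrder S L → IsInOrder T L → maxList S ≡ maxList T →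
  Fresh S x → Fresh T y → bufferSize (S ++ [ x ]) ≡ bufferSize (T ++ [ y ]) →
  maxList (S ++ [ x ]) ≡ maxList (T ++ [ y ])
snoc-sameMax {S} {T} {x = x} {y} S-level T-level sameMax x-fresh y-fresh same
  with x ≤? maxList S | y ≤? maxList T
... | yes x≤max | yes y≤max = trans (maxList-snoc-≤ S x≤max) (trans sameMax (sym (maxList-snoc-≤ T y≤max)))
... | no  x≰max | yes y≤max =
  ⊥-elim (snoc-high≢snoc-low S-level T-level sameMax (≰⇒> x≰max) y-fresh y≤max same)
... | yes x≤max | no  y≰max =
  ⊥-elim (snoc-high≢snoc-low T-level S-level (sym sameMax) (≰⇒> y≰max) x-fresh x≤max (sym same))
... | no  x≰max | no  y≰max = begin
  maxList (S ++ [ x ]) ≡⟨ maxList-snoc-> S (≰⇒> x≰max) ⟩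
  x                    ≡⟨ snoc-high-injective S-level T-level sameMax (≰⇒> x≰max) (≰⇒> y≰max) same ⟩
  y                    ≡⟨ sym (maxList-snoc-> T (≰⇒> y≰max)) ⟩
  maxList (T ++ [ y ]) ∎
  where open ≡-Reasoning

SameState : List ℕ → List ℕ → Set
SameState S T = maxList S ≡ maxList T × inOrder S ≡ inOrder T

SameState-snoc : ∀ {S T x y} → SameState S T → Fresh S x → Fresh T y →
  bufferSize (S ++ [ x ]) ≡ bufferSize (T ++ [ y ]) → SameState (S ++ [ x ]) (T ++ [ y ])
SameState-snoc {S} {T} {x} {y} (sameMax , sameLevel) x-fresh y-fresh same = sameMax′ , sameLevel′
  where
  sameMax′ : maxList (S ++ [ x ]) ≡ maxList (T ++ [ y ])
  sameMax′ = snoc-sameMax (inOrder-isInOrder S) (subst (IsInOrder T) (sym sameLevel) (inOrder-isInOrder T))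
               sameMax x-fresh y-fresh same
  sameLevel′ : inOrder (S ++ [ x ]) ≡ inOrder (T ++ [ y ])
  sameLevel′ = ∸-cancelˡ-≡ (IsInOrder⇒≤maxList (inOrder-isInOrder (S ++ [ x ])))
    (subst (inOrder (T ++ [ y ]) ≤_) (sym sameMax′) (IsInOrder⇒≤maxList (inOrder-isInOrder (T ++ [ y ]))))
    (trans same (cong (_∸ inOrder (T ++ [ y ])) (sym sameMax′)))

Unique-++-∷⇒∉ : ∀ {A : Set} (S : List A) {x P} → Unique (S ++ x ∷ P) → x ∉ S
Unique-++-∷⇒∉ (a ∷ S) (a∉ ∷ _) (here refl)  = All.lookup a∉ (∈-++⁺ʳ S (here refl)) refl
Unique-++-∷⇒∉ (a ∷ S) (_ ∷ u)  (there x∈S) = Unique-++-∷⇒∉ S u x∈S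

SameState-++ : ∀ {S T} P Q → length P ≡ length Q → Unique (S ++ P) → Unique (T ++ Q) →
  All (0 <_) P → All (0 <_) Q → SameState S T →
  (∀ k → bufferSize (S ++ take k P) ≡ bufferSize (T ++ take k Q)) →
  ∀ k → SameState (S ++ take k P) (T ++ take k Q)
SameState-++ {S} {T} P Q _ _ _ _ _ same _ zero =
  subst₂ SameState (sym (++-identityʳ S)) (sym (++-identityʳ T)) same
SameState-++ {S} {T} [] [] _ _ _ _ _ same _ (suc k) =
  subst₂ SameState (sym (++-identityʳ S)) (sym (++-identityʳ T)) same
SameState-++ {S} {T} (x ∷ P) (y ∷ Q) length≡ S-unique T-unique (0<x ∷ P-pos) (0<y ∷ Q-pos)
             same sameBuffers (suc k) =
  subst₂ SameState (++-assoc S [ x ] (take k P)) (++-assoc T [ y ] (take k Q))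
    (SameState-++ P Q (suc-injective length≡)
      (subst Unique (sym (++-assoc S [ x ] P)) S-unique) (subst Unique (sym (++-assoc T [ y ] Q)) T-unique)
      P-pos Q-pos
      (SameState-snoc same (0<x , Unique-++-∷⇒∉ S S-unique) (0<y , Unique-++-∷⇒∉ T T-unique) (sameBuffers 1))
      sameBuffers′ k)
  where
  sameBuffers′ : ∀ j → bufferSize ((S ++ [ x ]) ++ take j P) ≡ bufferSize ((T ++ [ y ]) ++ take j Q)
  sameBuffers′ j = begin
    bufferSize ((S ++ [ x ]) ++ take j P) ≡⟨ cong bufferSize (++-assoc S [ x ] (take j P)) ⟩
    bufferSize (S ++ take (suc j) (x ∷ P)) ≡⟨ sameBuffers (suc j) ⟩
    bufferSize (T ++ take (suc j) (y ∷ Q)) ≡⟨ cong bufferSize (sym (++-assoc T [ y ] (take j Q))) ⟩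
    bufferSize ((T ++ [ y ]) ++ take j Q) ∎
    where open ≡-Reasoning

AllPairs-lookup : ∀ {A : Set} {R : A → A → Set} {xs} → AllPairs R xs →
  ∀ {i j} → i <ᶠ j → R (List.lookup xs i) (List.lookup xs j)
AllPairs-lookup (Rx ∷ _)   {zero}  {suc j} _         = All.lookup Rx (∈-lookup j)
AllPairs-lookup (_ ∷ Rxs)  {suc i} {suc j} (s≤s i<j) = AllPairs-lookup Rxs i<j

positions : ∀ {n xs} {A : Vec ℕ n} → xs ⊆ toList A → Fin (length xs) → Fin n
positions {A = _ Vec.∷ _} (_ ∷ʳ σ)   i       = suc (positions σ i)
positions {A = _ Vec.∷ _} (refl ∷ σ) zero    = zero
positions {A = _ Vec.∷ _} (refl ∷ σ) (suc i) = suc (positions σ i)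
positions {A = Vec.[]}    []         ()

lookup-positions : ∀ {n xs} {A : Vec ℕ n} (σ : xs ⊆ toList A) i →
  Vec.lookup A (positions σ i) ≡ List.lookup xs i
lookup-positions {A = _ Vec.∷ _} (_ ∷ʳ σ)   i       = lookup-positions σ i
lookup-positions {A = _ Vec.∷ _} (refl ∷ σ) zero    = refl
lookup-positions {A = _ Vec.∷ _} (refl ∷ σ) (suc i) = lookup-positions σ i
lookup-positions {A = Vec.[]}    []         ()

positions-monotone : ∀ {n xs} {A : Vec ℕ n} (σ : xs ⊆ toList A) {i j} →
  i <ᶠ j → positions σ i <ᶠ positions σ j
positions-monotone {A = _ Vec.∷ _} (_ ∷ʳ σ)   i<j       = s≤s (positions-monotone σ i<j)
positions-monotone {A = _ Vec.∷ _} (refl ∷ σ) {zero} {suc j} _ = s≤s z≤n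
positions-monotone {A = _ Vec.∷ _} (refl ∷ σ) {suc i} {suc j} (s≤s i<j) = s≤s (positions-monotone σ i<j)
positions-monotone {A = Vec.[]}    [] {()}

DecreasingLength≤ : ℕ → List ℕ → Set
DecreasingLength≤ k S = ∀ {ys} → ys ⊆ S → AllPairs _>_ ys → length ys ≤ k

-- Pigeonhole: two of any k + 1 entries of a decreasing subsequence share an ascending class.
SUS≤⇒DecreasingLength≤ : ∀ {n k} {A : Vec ℕ n} → SUS≤ k A → DecreasingLength≤ k (toList A)
SUS≤⇒DecreasingLength≤ {k = k} {A} (class , ascending) {ys} σ decreasing = ≮⇒≥ too-long
  where
  too-long : k < length ys → ⊥
  too-long k<length with pigeonhole k<length (class ∘ positions σ)
  ... | i , j , i<j , sameClass = <-asym
    (subst₂ _<_ (lookup-positions σ i) (lookup-positions σ j)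
      (ascending _ _ (positions-monotone σ i<j) sameClass))
    (AllPairs-lookup decreasing i<j)

oneTo : ℕ → List ℕ
oneTo n = map suc (upTo n)

∈-oneTo⁻ : ∀ {n z} → z ∈ oneTo n → 0 < z × z ≤ n
∈-oneTo⁻ z∈ with ∈-map⁻ suc z∈
... | _ , i∈ , refl = s≤s z≤n , ∈-upTo⁻ i∈

∈-oneTo⁺ : ∀ {n z} → 0 < z → z ≤ n → z ∈ oneTo n
∈-oneTo⁺ {z = suc z} _ z<n = ∈-map⁺ suc (∈-upTo⁺ z<n)

module _ {n S} (S↭ : S ↭ oneTo n) where

  ↭oneTo⇒Unique : Unique S
  ↭oneTo⇒Unique = PermutationSetoid.Unique-resp-↭ (setoid ℕ) (↭⇒↭ₛ (↭-sym S↭))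
                    (Unique.map⁺ suc-injective (Unique.upTo⁺ n))

  ↭oneTo⇒∈⁻ : ∀ {z} → z ∈ S → 0 < z × z ≤ n
  ↭oneTo⇒∈⁻ = ∈-oneTo⁻ ∘ ∈-resp-↭ S↭

  ↭oneTo⇒∈⁺ : ∀ {z} → 0 < z → z ≤ n → z ∈ S
  ↭oneTo⇒∈⁺ 0<z z≤bound = ∈-resp-↭ (↭-sym S↭) (∈-oneTo⁺ 0<z z≤bound)

  ↭oneTo⇒positive : All (0 <_) S
  ↭oneTo⇒positive = All.tabulate (proj₁ ∘ ↭oneTo⇒∈⁻)

  ↭oneTo⇒Covers : ∀ {z} → z ∈ S → Covers S z
  ↭oneTo⇒Covers z∈S 0<j j≤z = ↭oneTo⇒∈⁺ 0<j (≤-trans j≤z (proj₂ (↭oneTo⇒∈⁻ z∈S)))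

↭oneTo⇒∈⇒∈ : ∀ {n S T z} → S ↭ oneTo n → T ↭ oneTo n → z ∈ S → z ∈ T
↭oneTo⇒∈⇒∈ S↭ T↭ z∈S = ∈-resp-↭ (↭-sym T↭) (∈-resp-↭ S↭ z∈S)

↭oneTo⇒SameState : ∀ {n A B} → A ↭ oneTo n → B ↭ oneTo n →
  (∀ k → bufferSize (take k A) ≡ bufferSize (take k B)) → ∀ k → SameState (take k A) (take k B)
↭oneTo⇒SameState {A = A} {B} A↭ B↭ =
  SameState-++ {[]} {[]} A B (trans (↭-length A↭) (sym (↭-length B↭)))
    (↭oneTo⇒Unique A↭) (↭oneTo⇒Unique B↭) (↭oneTo⇒positive A↭) (↭oneTo⇒positive B↭) (refl , refl)

take-++ : ∀ {A : Set} (R : List A) P k → take (length R + k) (R ++ P) ≡ R ++ take k P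
take-++ []      P k = refl
take-++ (r ∷ R) P k = cong (r ∷_) (take-++ R P k)

take-length-++ : ∀ {A : Set} (R : List A) P → take (length R) (R ++ P) ≡ R
take-length-++ []      P = refl
take-length-++ (r ∷ R) P = cong (r ∷_) (take-length-++ R P)

∈-++-∷⁻ : ∀ {A : Set} (R : List A) {y z Q} → z ∈ R ++ y ∷ Q → z ∉ R → z ≢ y → z ∈ Q
∈-++-∷⁻ R z∈ z∉R z≢y with ∈-++⁻ R z∈
... | inj₁ z∈R          = ⊥-elim (z∉R z∈R)
... | inj₂ (here z≡y)  = ⊥-elim (z≢y z≡y)
... | inj₂ (there z∈Q) = z∈Q

level<fresh : ∀ {S T L x} → IsInOrder S L → IsInOrder T L → x ∈ S → Fresh T x → suc L < x
level<fresh (_ , next∉S) T-level x∈S x-fresh =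
  ≤∧≢⇒< (fresh⇒>level T-level x-fresh) (λ next≡x → next∉S (subst (_∈ _) (sym next≡x) x∈S))

late-smaller⇒¬DecreasingLength≤3 : ∀ {n A B} R {x y P Q₁ Q₂} → B ↭ oneTo n →
  (∀ k → SameState (take k A) (take k B)) →
  A ≡ R ++ x ∷ P → B ≡ R ++ y ∷ Q₁ ++ x ∷ Q₂ → x < y → ¬ DecreasingLength≤ 3 B
late-smaller⇒¬DecreasingLength≤3 R {x} {y} {P} {Q₁} {Q₂} B↭ sameStates refl refl x<y B-short =
  1+n≰n (B-short descent (Linked⇒AllPairs (λ a>b b>c → <-trans b>c a>b) (y<H ∷ x<y ∷ w<x ∷ [-])))
  where
  T : List ℕ
  T = R ++ y ∷ Q₁
  B≡T++ : R ++ y ∷ Q₁ ++ x ∷ Q₂ ≡ T ++ x ∷ Q₂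
  B≡T++ = sym (++-assoc R (y ∷ Q₁) (x ∷ Q₂))
  B-unique : Unique (T ++ x ∷ Q₂)
  B-unique = subst Unique B≡T++ (↭oneTo⇒Unique B↭)
  x∈B : x ∈ R ++ y ∷ Q₁ ++ x ∷ Q₂
  x∈B = ∈-++⁺ʳ R (there (∈-++⁺ʳ Q₁ (here refl)))
  sameStateAt : ∀ k → SameState (R ++ take k (x ∷ P)) (R ++ take k (y ∷ Q₁ ++ x ∷ Q₂))
  sameStateAt k = subst₂ SameState (take-++ R (x ∷ P) k) (take-++ R (y ∷ Q₁ ++ x ∷ Q₂) k)
                    (sameStates (length R + k))
  y<H : y < maxList R
  y<H = snoc-maxList-≡⇒<maxList
          (proj₁ (↭oneTo⇒∈⁻ B↭ (∈-++⁺ʳ R (here refl))) , Unique-++-∷⇒∉ R (↭oneTo⇒Unique B↭))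
          x<y (proj₁ (sameStateAt 1))
  sameLevel : inOrder (R ++ x ∷ take (length Q₁) P) ≡ inOrder T
  sameLevel = subst (λ Z → inOrder (R ++ x ∷ take (length Q₁) P) ≡ inOrder (R ++ y ∷ Z))
                (take-length-++ Q₁ (x ∷ Q₂)) (proj₂ (sameStateAt (suc (length Q₁))))
  w<x : suc (inOrder T) < x
  w<x = level<fresh (subst (IsInOrder _) sameLevel (inOrder-isInOrder _)) (inOrder-isInOrder T)
          (∈-++⁺ʳ R (here refl)) (proj₁ (↭oneTo⇒∈⁻ B↭ x∈B) , Unique-++-∷⇒∉ T B-unique)
  w∈Q₂ : suc (inOrder T) ∈ Q₂
  w∈Q₂ = ∈-++-∷⁻ T (subst (_ ∈_) B≡T++ (↭oneTo⇒Covers B↭ x∈B (s≤s z≤n) (<⇒≤ w<x)))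
           (proj₂ (inOrder-isInOrder T)) (<⇒≢ w<x)
  descent : maxList R ∷ y ∷ x ∷ suc (inOrder T) ∷ [] ⊆ R ++ y ∷ Q₁ ++ x ∷ Q₂
  descent = ++⁺ (from∈ (maxList∈ R (≤-<-trans z≤n y<H))) (refl ∷ ++⁺ˡ Q₁ (refl ∷ from∈ w∈Q₂))

divergence⇒¬DecreasingLength≤3 : ∀ {n A B} R {x y P Q} → A ↭ oneTo n → B ↭ oneTo n →
  (∀ k → bufferSize (take k A) ≡ bufferSize (take k B)) →
  A ≡ R ++ x ∷ P → B ≡ R ++ y ∷ Q → x < y → ¬ DecreasingLength≤ 3 B
divergence⇒¬DecreasingLength≤3 R {x} {Q = Q} A↭ B↭ sameBuffers refl refl x<y with ∈-∃++ x∈Q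
  where
  x∈Q : x ∈ Q
  x∈Q = ∈-++-∷⁻ R (↭oneTo⇒∈⇒∈ A↭ B↭ (∈-++⁺ʳ R (here refl)))
          (Unique-++-∷⇒∉ R (↭oneTo⇒Unique A↭)) (<⇒≢ x<y)
... | _ , _ , refl =
  late-smaller⇒¬DecreasingLength≤3 R B↭ (↭oneTo⇒SameState A↭ B↭ sameBuffers) refl refl x<y

module _ {n A B} (A↭ : A ↭ oneTo n) (B↭ : B ↭ oneTo n)
  (A-short : DecreasingLength≤ 3 A) (B-short : DecreasingLength≤ 3 B)
  (sameBuffers : ∀ k → bufferSize (take k A) ≡ bufferSize (take k B)) where

  ≡-after-prefix : ∀ R P Q → length P ≡ length Q → A ≡ R ++ P → B ≡ R ++ Q → P ≡ Q
  ≡-after-prefix R []      []      _        _    _    = refl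
  ≡-after-prefix R (x ∷ P) (y ∷ Q) length≡ A≡ B≡ with <-cmp x y
  ... | tri< x<y _ _ = ⊥-elim (divergence⇒¬DecreasingLength≤3 R A↭ B↭ sameBuffers A≡ B≡ x<y B-short)
  ... | tri> _ _ y<x = ⊥-elim (divergence⇒¬DecreasingLength≤3 R B↭ A↭ (sym ∘ sameBuffers) B≡ A≡ y<x A-short)
  ... | tri≈ _ refl _ = cong (x ∷_) (≡-after-prefix (R ++ [ x ]) P Q (suc-injective length≡)
                          (trans A≡ (sym (++-assoc R [ x ] P))) (trans B≡ (sym (++-assoc R [ x ] Q))))

  ↭oneTo-sameBuffers⇒≡ : A ≡ B
  ↭oneTo-sameBuffers⇒≡ = ≡-after-prefix [] A B (trans (↭-length A↭) (sym (↭-length B↭))) refl refl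

map-≡⇒∈-≡ : ∀ {f g : ℕ → ℕ} xs → map f xs ≡ map g xs → ∀ {z} → z ∈ xs → f z ≡ g z
map-≡⇒∈-≡ (x ∷ xs) fxs≡gxs (here refl)  = proj₁ (∷-injective fxs≡gxs)
map-≡⇒∈-≡ (x ∷ xs) fxs≡gxs (there z∈xs) = map-≡⇒∈-≡ xs (proj₂ (∷-injective fxs≡gxs)) z∈xs

-- buffer P only records times 1, …, length P; time 0 is trivial and later times repeat time length P.
buffer-≡⇒bufferSize-take-≡ : ∀ P Q → length P ≡ length Q → 0 < length P → buffer P ≡ buffer Q →
  ∀ k → bufferSize (take k P) ≡ bufferSize (take k Q)
buffer-≡⇒bufferSize-take-≡ P Q length≡ 0<length buffer≡ = atTime
  where
  atTime≤length : ∀ {i} → i ∈ oneTo (length P) → bufferSize (take i P) ≡ bufferSize (take i Q)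
  atTime≤length = map-≡⇒∈-≡ (oneTo (length P))
                    (trans buffer≡ (cong (map (bufferAt Q) ∘ oneTo) (sym length≡)))
  atTime : ∀ k → bufferSize (take k P) ≡ bufferSize (take k Q)
  atTime zero = refl
  atTime (suc k) with suc k ≤? length P
  ... | yes k<length = atTime≤length (∈-oneTo⁺ (s≤s z≤n) k<length)
  ... | no  k≮length = begin
    bufferSize (take (suc k) P)    ≡⟨ cong bufferSize (take-all (suc k) P length≤) ⟩
    bufferSize P                   ≡⟨ cong bufferSize (sym (take-all (length P) P ≤-refl)) ⟩
    bufferSize (take (length P) P) ≡⟨ atTime≤length (∈-oneTo⁺ 0<length ≤-refl) ⟩
    bufferSize (take (length P) Q) ≡⟨ cong bufferSize (take-all (length P) Q (≤-reflexive (sym length≡))) ⟩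
    bufferSize Q                   ≡⟨ cong bufferSize (sym (take-all (suc k) Q (subst (_≤ suc k) length≡ length≤))) ⟩
    bufferSize (take (suc k) Q)    ∎
    where
    open ≡-Reasoning
    length≤ : length P ≤ suc k
    length≤ = <⇒≤ (≰⇒> k≮length)

theorem1 : (n : ℕ) → n ≥ 1 → (A B : Vec ℕ n) →
    IsPermutation A → IsPermutation B →
    SUS≤ 3 A → SUS≤ 3 B →
    buffer (toList A) ≡ buffer (toList B) → A ≡ B
theorem1 n n≥1 A B A↭ B↭ A-sus B-sus buffer≡ =
  trans (sym (cast-is-id refl A)) (toList-injective refl A B toList≡)
  where
  toList≡ : toList A ≡ toList B
  toList≡ = ↭oneTo-sameBuffers⇒≡ A↭ B↭ (SUS≤⇒DecreasingLength≤ A-sus) (SUS≤⇒DecreasingLength≤ B-sus)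
    (buffer-≡⇒bufferSize-take-≡ (toList A) (toList B) (trans (length-toList A) (sym (length-toList B)))
      (subst (0 <_) (sym (length-toList A)) n≥1) buffer≡)
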